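{- For $n \ge 4$ (so that the sequences below are well defined), let $E_n = a,a,b,b,\ldots,b$ ($n$ items in total: two copies of $a$ followed by $n-2$ copies of $b$, with $a\neq b$), and let $W_n = a_1,a_0,a_2,a_0,\ldots,a_{n/2},a_0$ if $n$ is even and $W_n = a_1,a_0,a_2,a_0,\ldots,a_{\lfloor n/2\rfloor},a_0,a_{\lceil n/2\rceil}$ if $n$ is odd, where $a_0,a_1,a_2,\ldots$ are pairwise distinct items. Then the aggregate frequencies are: \begin{itemize} \item $\mathrm{Nai}(E_n)=n-4+\frac{8}{n}$; $\mathrm{Nai}(W_n)=\frac{n}{4}+\frac12$ for even $n$ and $\frac{n}{4}+\frac{3}{4n}$ for odd $n$; \item $\mathrm{Eag}(E_n)=2$; $\mathrm{Eag}(W_n)=\mathrm{Nai}(W_n)$; \item $\mathrm{Maj}(E_n)=n-6+\frac{16}{n}$; $\mathrm{Maj}(W_n)=1$; \item $\mathrm{Opt}(E_n)=n-4+\frac{8}{n}$; $\mathrm{Opt}(W_n)=\frac n2-\frac12+\frac1n$ for even $n$ and $\frac n2-1+\frac{3}{2n}$ for odd $n$. \end{itemize}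
   Context: Online frequent items problem with a buffer of size one. An input sequence is $I=a_1,\ldots,a_n$ of items from an infinite universe $\mathcal U$; $n=|I|$. Items arrive one at a time. An algorithm maintains a buffer holding one item; $s_t$ denotes the buffer content after processing time step $t$. At time step $1$ the buffer receives $a_1$; at each later step $t$ the algorithm either keeps $s_t=s_{t-1}$ or replaces it, $s_t=a_t$. An online algorithm decides at step $t$ knowing only $a_1,\ldots,a_t$. The frequency of $a$ in $I$ is $f_I(a)=n_I(a)/n$ where $n_I(a)=|\{i: a_i=a\}|$. The aggregate frequency (profit) of algorithm $\mathcal A$ on $I$ is $\mathcal A(I)=\sum_{t=1}^n f_I(s^{\mathcal A}_t)$, to be maximized. Algorithms: Nai sets $s_t=a_t$ for all $t$. Eag: let $t^*=\min\{t\in\{1,\ldots,n-1\}: a_t=a_{t+1}\}$ if such $t$ exists, else $t^*=n$; Eag sets $s_t=a_t$ for $t\le t^*$ and $s_t=a_{t^*}$ for $t>t^*$. Maj keeps a counter, initially $0$: when an item arrives, if the counter is $0$ it buffers the item and sets the counter to $1$; otherwise, if the arriving item equals the buffered item the counter is incremented, else the counter is decremented (the buffer unchanged). Opt is an optimal offline algorithm: it knows the whole sequence in advance and maximizes the aggregate frequency subject to the same buffer rules ($s_1=a_1$, $s_t\in\{s_{t-1},a_t\}$). -}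

module Defs where

open import Data.Nat using (ℕ; zero; suc; _∸_; _≟_; _%_; _/_)
open import Data.Integer using (+_)
open import Data.Rational using (ℚ; 0ℚ; _+_; _≤_) renaming (_/_ to _/ℚ_)
open import Data.List using (List; []; _∷_; length; filter; replicate; map; foldr; upTo)
open import Data.Product using (Σ; _×_; _,_)
open import Data.Sum using (_⊎_)
open import Data.Unit using (⊤)
open import Data.Empty using (⊥)
open import Relation.Nullary using (yes; no)
open import Relation.Binary.PropositionalEquality using (_≡_)

Item : Set
Item = ℕ

-- k ÷ d as a rational (d = 0 gives 0; only used with d ≥ 1 below)
_÷_ : ℕ → ℕ → ℚ
k ÷ zero    = 0ℚ
k ÷ (suc m) = (+ k) /ℚ (suc m)

occ : List Item → Item → ℕ
occ I a = length (filter (λ x → x ≟ a) I)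

freq : List Item → Item → ℚ
freq I a = occ I a ÷ length I

-- aggregate frequency of the buffer-content sequence S = s_1,…,s_n on I
profit : List Item → List Item → ℚ
profit I S = foldr (λ s acc → freq I s + acc) 0ℚ S

nai : List Item → List Item
nai I = I

eagGo : Item → List Item → List Item
eagGo x []       = x ∷ []
eagGo x (y ∷ rs) with x ≟ y
... | yes _ = x ∷ replicate (length (y ∷ rs)) x
... | no  _ = x ∷ eagGo y rs

eag : List Item → List Item
eag []       = []
eag (x ∷ rs) = eagGo x rs

majGo : Item → ℕ → List Item → List Item
majGo b c [] = []
majGo b zero (x ∷ xs) = x ∷ majGo x 1 xs
majGo b (suc c) (x ∷ xs) with x ≟ b
... | yes _ = b ∷ majGo b (suc (suc c)) xs
... | no  _ = b ∷ majGo b c xs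

-- initial buffer content is irrelevant since the counter starts at 0
maj : List Item → List Item
maj I = majGo 0 0 I

ValidFrom : Item → List Item → List Item → Set
ValidFrom p []       []       = ⊤
ValidFrom p []       (_ ∷ _)  = ⊥
ValidFrom p (_ ∷ _)  []       = ⊥
ValidFrom p (a ∷ as) (s ∷ ss) = ((s ≡ p) ⊎ (s ≡ a)) × ValidFrom s as ss

Valid : List Item → List Item → Set
Valid []       []       = ⊤
Valid []       (_ ∷ _)  = ⊥
Valid (_ ∷ _)  []       = ⊥
Valid (a ∷ as) (s ∷ ss) = (s ≡ a) × ValidFrom s as ss

OptValue : List Item → ℚ → Set
OptValue I v = Σ (List Item) (λ S → Valid I S × profit I S ≡ v)
             × ((S : List Item) → Valid I S → profit I S ≤ v)

E : Item → Item → ℕ → List Item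
E a b n = a ∷ a ∷ replicate (n ∸ 2) b

-- W_n with items a_i = f i : position i (0-based) holds a_0 if i is odd,
-- a_{i/2+1} if i is even; i.e. a_1,a_0,a_2,a_0,…
wItem : (ℕ → Item) → ℕ → Item
wItem f i with i % 2
... | zero  = f (suc (i / 2))
... | suc _ = f 0

W : (ℕ → Item) → ℕ → List Item
W f n = map (wItem f) (upTo n)

-- The profit of a buffer sequence S on I is (Σₜ n_I(sₜ)) / |I|, so each claim is an occurrence
-- count, turned into the stated rational by cross-multiplication.  On Wₙ neighbouring items always differ, so Eag behaves like Nai,
-- and Maj holds each aᵢ (i ≥ 1) for exactly two steps.  For Opt, a feasible sequence earns n_I(a₁)
-- at step 1 and at most the largest count at every later step: on Wₙ this bound is reached by
-- switching to a₀ at step 2, while on Eₙ step 2 is forced to keep a and Nai reaches the bound.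
module Submission where

open import Data.Empty using (⊥-elim)
open import Data.Integer as ℤ using ()
import Data.Integer.Properties as ℤ
open import Data.List using (List; []; _∷_; _++_; length; replicate; map; filter; applyUpTo)
import Data.List.Properties as List
open import Data.List.Relation.Unary.Linked using (Linked; []; [-]; _∷_)
open import Data.Nat as ℕ using (ℕ; zero; suc; z≤n; s≤s; _≤_; _<_; _*_; _%_)
open import Data.Nat.DivMod using (m*n%n≡0; m*n/n≡m; [m+kn]%n≡m%n)
open import Data.Nat.ListAction using (sum)
open import Data.Nat.ListAction.Properties using (sum-++)
import Data.Nat.Properties as ℕₚ
open import Data.Nat.Tactic.RingSolver using (solve-∀)
open import Data.Product using (_×_; _,_; proj₁; proj₂)
open import Data.Rational as ℚ using (0ℚ; _+_; _-_)
import Data.Rational.Properties as ℚ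
open import Data.Rational.Unnormalised as ℚᵘ using (mkℚᵘ; *≡*; *≤*)
import Data.Rational.Unnormalised.Properties as ℚᵘ
open import Data.Sum as Sum using (_⊎_; inj₁; inj₂)
open import Function using (_$_; _∘_)
open import Function.Definitions using (Injective)
open import Relation.Binary using (tri<; tri≈; tri>)
open import Relation.Binary.PropositionalEquality
open import Relation.Nullary using (¬_; yes; no)

open import Defs

÷-toℚᵘ : ∀ a l → ℚ.toℚᵘ (a ÷ suc l) ℚᵘ.≃ mkℚᵘ (ℤ.+ a) l
÷-toℚᵘ a l = ℚ.toℚᵘ-fromℚᵘ (mkℚᵘ (ℤ.+ a) l)

-- _÷_ unfolds to a gcd-normalised rational, so the natural-number arguments of the lemmas
-- below cannot be inferred from a goal and are passed explicitly.
÷-cross : ∀ a l b l′ → a * suc l′ ≡ b * suc l → a ÷ suc l ≡ b ÷ suc l′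
÷-cross a l b l′ eq = ℚ.fromℚᵘ-cong {mkℚᵘ (ℤ.+ a) l} {mkℚᵘ (ℤ.+ b) l′} (*≡* (begin
  ℤ.+ a ℤ.* ℤ.+ suc l′  ≡⟨ ℤ.pos-* a (suc l′) ⟨
  ℤ.+ (a * suc l′)      ≡⟨ cong ℤ.+_ eq ⟩
  ℤ.+ (b * suc l)       ≡⟨ ℤ.pos-* b (suc l) ⟩
  ℤ.+ b ℤ.* ℤ.+ suc l   ∎))
  where open ≡-Reasoning

÷-mono-≤ : ∀ {a b} L → a ≤ b → a ÷ L ℚ.≤ b ÷ L
÷-mono-≤ zero    _   = ℚ.≤-refl
÷-mono-≤ {a} {b} (suc l) a≤b = ℚ.toℚᵘ-cancel-≤
  (ℚᵘ.≤-respˡ-≃ (ℚᵘ.≃-sym (÷-toℚᵘ a l)) (ℚᵘ.≤-respʳ-≃ (ℚᵘ.≃-sym (÷-toℚᵘ b l))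
    (*≤* (ℤ.*-monoʳ-≤-nonNeg (ℤ.+ suc l) (ℤ.+≤+ a≤b)))))

÷-+-÷ : ∀ a l b l′ → a ÷ suc l + b ÷ suc l′ ≡ (a * suc l′ ℕ.+ b * suc l) ÷ (suc l * suc l′)
÷-+-÷ a l b l′ = ℚ.toℚᵘ-injective (begin
  ℚ.toℚᵘ (a ÷ suc l + b ÷ suc l′)                            ≈⟨ ℚ.toℚᵘ-homo-+ (a ÷ suc l) (b ÷ suc l′) ⟩
  ℚ.toℚᵘ (a ÷ suc l) ℚᵘ.+ ℚ.toℚᵘ (b ÷ suc l′)                ≈⟨ ℚᵘ.+-cong (÷-toℚᵘ a l) (÷-toℚᵘ b l′) ⟩
  mkℚᵘ (ℤ.+ a) l ℚᵘ.+ mkℚᵘ (ℤ.+ b) l′                        ≈⟨ *≡* (cong (ℤ._* ℤ.+ (suc l * suc l′)) numerator) ⟩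
  mkℚᵘ (ℤ.+ (a * suc l′ ℕ.+ b * suc l)) (l′ ℕ.+ l * suc l′)  ≈⟨ ÷-toℚᵘ _ _ ⟨
  ℚ.toℚᵘ ((a * suc l′ ℕ.+ b * suc l) ÷ (suc l * suc l′))     ∎)
  where
  open ℚᵘ.≃-Reasoning
  numerator : ℤ.+ a ℤ.* ℤ.+ suc l′ ℤ.+ ℤ.+ b ℤ.* ℤ.+ suc l ≡ ℤ.+ (a * suc l′ ℕ.+ b * suc l)
  numerator = trans (cong₂ ℤ._+_ (sym (ℤ.pos-* a (suc l′))) (sym (ℤ.pos-* b (suc l))))
                    (sym (ℤ.pos-+ (a * suc l′) (b * suc l)))

÷-+-distribʳ : ∀ a b L → a ÷ L + b ÷ L ≡ (a ℕ.+ b) ÷ L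
÷-+-distribʳ a b zero    = ℚ.+-identityˡ 0ℚ
÷-+-distribʳ a b (suc l) =
  trans (÷-+-÷ a l b l) (÷-cross (a * suc l ℕ.+ b * suc l) (l ℕ.+ l * suc l) (a ℕ.+ b) l (eq a b l))
  where
  eq : ∀ a b l → (a * suc l ℕ.+ b * suc l) * suc l ≡ (a ℕ.+ b) * (suc l * suc l)
  eq = solve-∀

n÷n≡1 : ∀ n → suc n ÷ suc n ≡ 1 ÷ 1
n÷n≡1 n = ÷-cross (suc n) n 1 0 (trans (ℕₚ.*-identityʳ (suc n)) (sym (ℕₚ.*-identityˡ (suc n))))

x≡w-y+z : ∀ {x y w z} → x + y ≡ w + z → x ≡ w - y + z
x≡w-y+z {x} {y} {w} {z} eq = begin
  x                ≡⟨ ℚ.+-identityʳ x ⟨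
  x + 0ℚ           ≡⟨ cong (x +_) (ℚ.+-inverseʳ y) ⟨
  x + (y - y)      ≡⟨ ℚ.+-assoc x y (ℚ.- y) ⟨
  (x + y) - y      ≡⟨ cong (_- y) eq ⟩
  (w + z) - y      ≡⟨ ℚ.+-assoc w z (ℚ.- y) ⟩
  w + (z - y)      ≡⟨ cong (w +_) (ℚ.+-comm z (ℚ.- y)) ⟩
  w + (ℚ.- y + z)  ≡⟨ ℚ.+-assoc w (ℚ.- y) z ⟨
  w - y + z        ∎
  where open ≡-Reasoning

÷+÷-cross : ∀ a l b l′ c k d k′ →
  (a * suc l′ ℕ.+ b * suc l) * (suc k * suc k′) ≡ (c * suc k′ ℕ.+ d * suc k) * (suc l * suc l′) →
  a ÷ suc l + b ÷ suc l′ ≡ c ÷ suc k + d ÷ suc k′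
÷+÷-cross a l b l′ c k d k′ eq = begin
  a ÷ suc l + b ÷ suc l′                         ≡⟨ ÷-+-÷ a l b l′ ⟩
  (a * suc l′ ℕ.+ b * suc l) ÷ (suc l * suc l′)  ≡⟨ ÷-cross (a * suc l′ ℕ.+ b * suc l) (l′ ℕ.+ l * suc l′)
                                                             (c * suc k′ ℕ.+ d * suc k) (k′ ℕ.+ k * suc k′) eq ⟩
  (c * suc k′ ℕ.+ d * suc k) ÷ (suc k * suc k′)  ≡⟨ ÷-+-÷ c k d k′ ⟨
  c ÷ suc k + d ÷ suc k′                         ∎
  where open ≡-Reasoning

÷≡÷+÷ : ∀ c d p d₁ q d₂ →
  c * (suc d₁ * suc d₂) ≡ (p * suc d₂ ℕ.+ q * suc d₁) * suc d →
  c ÷ suc d ≡ p ÷ suc d₁ + q ÷ suc d₂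
÷≡÷+÷ c d p d₁ q d₂ eq = trans (÷-cross c d (p * suc d₂ ℕ.+ q * suc d₁) (d₂ ℕ.+ d₁ * suc d₂) eq) (sym (÷-+-÷ p d₁ q d₂))

÷≡÷-÷+÷ : ∀ c d p d₁ q d₂ r d₃ →
  (c * suc d₂ ℕ.+ q * suc d) * (suc d₁ * suc d₃) ≡ (p * suc d₃ ℕ.+ r * suc d₁) * (suc d * suc d₂) →
  c ÷ suc d ≡ p ÷ suc d₁ - q ÷ suc d₂ + r ÷ suc d₃
÷≡÷-÷+÷ c d p d₁ q d₂ r d₃ eq = x≡w-y+z {c ÷ suc d} {q ÷ suc d₂} {p ÷ suc d₁} {r ÷ suc d₃} (÷+÷-cross c d q d₂ p d₁ r d₃ eq)

occ-here : ∀ a xs → occ (a ∷ xs) a ≡ suc (occ xs a)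
occ-here a xs = cong length (List.filter-accept (ℕ._≟ a) refl)

occ-there : ∀ {x a} xs → ¬ x ≡ a → occ (x ∷ xs) a ≡ occ xs a
occ-there xs x≢a = cong length (List.filter-reject (ℕ._≟ _) x≢a)

occ-replicate : ∀ k x → occ (replicate k x) x ≡ k
occ-replicate zero    x = refl
occ-replicate (suc k) x = trans (occ-here x _) (cong suc (occ-replicate k x))

occ-replicate-≢ : ∀ k {y x} → ¬ y ≡ x → occ (replicate k y) x ≡ 0
occ-replicate-≢ zero    _   = refl
occ-replicate-≢ (suc k) y≢x = trans (occ-there (replicate k _) y≢x) (occ-replicate-≢ k y≢x)

occ-++ : ∀ xs ys a → occ (xs ++ ys) a ≡ occ xs a ℕ.+ occ ys a
occ-++ xs ys a = trans (cong length (List.filter-++ (ℕ._≟ a) xs ys)) (List.length-++ (filter (ℕ._≟ a) xs))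

occ-≤-length : ∀ xs a → occ xs a ≤ length xs
occ-≤-length xs a = List.length-filter (ℕ._≟ a) xs

occSum : List Item → List Item → ℕ
occSum I S = sum (map (occ I) S)

occSum-replicate : ∀ I k x → occSum I (replicate k x) ≡ k * occ I x
occSum-replicate I zero    x = refl
occSum-replicate I (suc k) x = cong (occ I x ℕ.+_) (occSum-replicate I k x)

occSum-++ : ∀ I xs ys → occSum I (xs ++ ys) ≡ occSum I xs ℕ.+ occSum I ys
occSum-++ I xs ys = trans (cong sum (List.map-++ (occ I) xs ys)) (sum-++ (map (occ I) xs) _)

profit≡occSum÷length : ∀ I S → profit I S ≡ occSum I S ÷ length I
profit≡occSum÷length I []      = sym (0÷≡0 (length I))
  where
  0÷≡0 : ∀ L → 0 ÷ L ≡ 0ℚ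
  0÷≡0 zero    = refl
  0÷≡0 (suc l) = ℚ.0/n≡0 (suc l)
profit≡occSum÷length I (s ∷ S) =
  trans (cong (λ q → freq I s + q) (profit≡occSum÷length I S)) (÷-+-distribʳ (occ I s) (occSum I S) (length I))

validFrom-length : ∀ {p as ss} → ValidFrom p as ss → length ss ≡ length as
validFrom-length {as = []}    {[]}    _       = refl
validFrom-length {as = _ ∷ _} {_ ∷ _} (_ , v) = cong suc (validFrom-length v)

validFrom-replicate : ∀ p as → ValidFrom p as (replicate (length as) p)
validFrom-replicate p []       = _
validFrom-replicate p (_ ∷ as) = inj₁ refl , validFrom-replicate p as

validFrom-self : ∀ p as → ValidFrom p as as
validFrom-self p []       = _
validFrom-self p (a ∷ as) = inj₂ refl , validFrom-self a as

occSum-≤ : ∀ I B → (∀ x → occ I x ≤ B) → ∀ S → occSum I S ≤ length S * B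
occSum-≤ I B bound []      = z≤n
occSum-≤ I B bound (s ∷ S) = ℕₚ.+-mono-≤ (bound s) (occSum-≤ I B bound S)

validFrom-occSum-≤ : ∀ I B → (∀ x → occ I x ≤ B) → ∀ {p as ss} → ValidFrom p as ss →
  occSum I ss ≤ length as * B
validFrom-occSum-≤ I B bound {ss = ss} valid =
  subst (λ ℓ → occSum I ss ≤ ℓ * B) (validFrom-length valid) (occSum-≤ I B bound ss)

optValue-attained : ∀ I S B → Valid I S → occSum I S ≡ B →
  (∀ S′ → Valid I S′ → occSum I S′ ≤ B) → OptValue I (B ÷ length I)
optValue-attained I S B valid S≡B maximal =
    (S , valid , trans (profit≡occSum÷length I S) (cong (_÷ length I) S≡B))
  , λ S′ valid′ → subst (ℚ._≤ B ÷ length I) (sym (profit≡occSum÷length I S′))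
                        (÷-mono-≤ (length I) (maximal S′ valid′))

optValue-switch-to-second : ∀ x y R → (∀ z → occ (x ∷ y ∷ R) z ≤ occ (x ∷ y ∷ R) y) →
  OptValue (x ∷ y ∷ R)
    ((occ (x ∷ y ∷ R) x ℕ.+ suc (length R) * occ (x ∷ y ∷ R) y) ÷ suc (suc (length R)))
optValue-switch-to-second x y R maximal =
  optValue-attained I (x ∷ y ∷ replicate (length R) y) _
    (refl , inj₂ refl , validFrom-replicate y R)
    (cong (occ I x ℕ.+_) (occSum-replicate I (suc (length R)) y))
    λ { (s ∷ S) (refl , valid) → ℕₚ.+-monoʳ-≤ (occ I x) (validFrom-occSum-≤ I (occ I y) maximal valid) }
  where
  I = x ∷ y ∷ R

eagGo-repeat : ∀ x rs → eagGo x (x ∷ rs) ≡ x ∷ replicate (suc (length rs)) x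
eagGo-repeat x rs with x ℕ.≟ x
... | yes _   = refl
... | no  x≢x = ⊥-elim (x≢x refl)

linked⇒eag≡id : ∀ {I} → Linked _≢_ I → eag I ≡ I
linked⇒eag≡id []  = refl
linked⇒eag≡id [-] = refl
linked⇒eag≡id {x ∷ y ∷ rs} (x≢y ∷ linked) with x ℕ.≟ y
... | yes x≡y = ⊥-elim (x≢y x≡y)
... | no  _   = cong (x ∷_) (linked⇒eag≡id linked)

majGo-agree : ∀ b c xs → majGo b (suc c) (b ∷ xs) ≡ b ∷ majGo b (suc (suc c)) xs
majGo-agree b c xs with b ℕ.≟ b
... | yes _   = refl
... | no  b≢b = ⊥-elim (b≢b refl)

majGo-disagree : ∀ {x b} c xs → ¬ x ≡ b → majGo b (suc c) (x ∷ xs) ≡ b ∷ majGo b c xs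
majGo-disagree {x} {b} c xs x≢b with x ℕ.≟ b
... | yes x≡b = ⊥-elim (x≢b x≡b)
... | no  _   = refl

-- With the counter at 0 the buffered item is about to be overwritten.
majGo-empty-counter : ∀ b T → majGo b 0 T ≡ maj T
majGo-empty-counter b []      = refl
majGo-empty-counter b (_ ∷ _) = refl

majGo-replicate : ∀ b c k → majGo b (suc c) (replicate k b) ≡ replicate k b
majGo-replicate b c zero    = refl
majGo-replicate b c (suc k) = trans (majGo-agree b c _) (cong (b ∷_) (majGo-replicate b (suc c) k))

module Eₙ (a b : Item) (a≢b : ¬ a ≡ b) (m : ℕ) where

  I : List Item
  I = a ∷ a ∷ replicate (2 ℕ.+ m) b

  n : ℕ
  n = 4 ℕ.+ m

  length-I : length I ≡ n
  length-I = cong (λ ℓ → 2 ℕ.+ ℓ) (List.length-replicate (2 ℕ.+ m))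

  profit≡occSum÷n : ∀ S → profit I S ≡ occSum I S ÷ n
  profit≡occSum÷n S = trans (profit≡occSum÷length I S) (cong (occSum I S ÷_) length-I)

  b≢a : ¬ b ≡ a
  b≢a b≡a = a≢b (sym b≡a)

  occ-a : occ I a ≡ 2
  occ-a = trans (occ-here a _) (cong suc (trans (occ-here a _) (cong suc (occ-replicate-≢ (2 ℕ.+ m) b≢a))))

  occ-b : occ I b ≡ 2 ℕ.+ m
  occ-b = trans (occ-there _ a≢b) (trans (occ-there _ a≢b) (occ-replicate (2 ℕ.+ m) b))

  occ-≤ : ∀ x → occ I x ≤ 2 ℕ.+ m
  occ-≤ x with a ℕ.≟ x
  ... | yes refl = subst (_≤ 2 ℕ.+ m) (sym occ-a) (ℕₚ.m≤m+n 2 m)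
  ... | no  a≢x  = subst (_≤ 2 ℕ.+ m) (sym (trans (occ-there _ a≢x) (occ-there _ a≢x)))
                     (subst (occ (replicate (2 ℕ.+ m) b) x ≤_) (List.length-replicate (2 ℕ.+ m))
                       (occ-≤-length (replicate (2 ℕ.+ m) b) x))

  occSum-self : occSum I I ≡ 4 ℕ.+ (2 ℕ.+ m) * (2 ℕ.+ m)
  occSum-self = begin
    occ I a ℕ.+ (occ I a ℕ.+ occSum I (replicate (2 ℕ.+ m) b)) ≡⟨ cong₂ (λ u v → u ℕ.+ (u ℕ.+ v)) occ-a (occSum-replicate I (2 ℕ.+ m) b) ⟩
    2 ℕ.+ (2 ℕ.+ (2 ℕ.+ m) * occ I b)                         ≡⟨ cong (λ v → 4 ℕ.+ (2 ℕ.+ m) * v) occ-b ⟩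
    4 ℕ.+ (2 ℕ.+ m) * (2 ℕ.+ m)                               ∎
    where open ≡-Reasoning

  eag-I : eag I ≡ replicate n a
  eag-I = trans (eagGo-repeat a (replicate (2 ℕ.+ m) b))
                (cong (λ ℓ → a ∷ replicate (suc ℓ) a) (List.length-replicate (2 ℕ.+ m)))

  maj-I : maj I ≡ a ∷ a ∷ a ∷ a ∷ replicate m b
  maj-I = begin
    a ∷ majGo a 1 (a ∷ b ∷ b ∷ replicate m b)  ≡⟨ cong (a ∷_) (majGo-agree a 0 _) ⟩
    a ∷ a ∷ majGo a 2 (b ∷ b ∷ replicate m b)  ≡⟨ cong (λ S → a ∷ a ∷ S) (majGo-disagree 1 _ b≢a) ⟩
    a ∷ a ∷ a ∷ majGo a 1 (b ∷ replicate m b)  ≡⟨ cong (λ S → a ∷ a ∷ a ∷ S) (majGo-disagree 0 _ b≢a) ⟩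
    a ∷ a ∷ a ∷ a ∷ majGo a 0 (replicate m b)  ≡⟨ cong (λ S → a ∷ a ∷ a ∷ a ∷ S) (majGo-fresh m) ⟩
    a ∷ a ∷ a ∷ a ∷ replicate m b              ∎
    where
    open ≡-Reasoning
    majGo-fresh : ∀ k → majGo a 0 (replicate k b) ≡ replicate k b
    majGo-fresh zero    = refl
    majGo-fresh (suc k) = cong (b ∷_) (majGo-replicate b 0 k)

  occSum-maj : occSum I (maj I) ≡ 8 ℕ.+ m * (2 ℕ.+ m)
  occSum-maj = begin
    occSum I (maj I)                                   ≡⟨ cong (occSum I) maj-I ⟩
    occSum I (replicate 4 a ++ replicate m b)          ≡⟨ occSum-++ I (replicate 4 a) (replicate m b) ⟩
    occSum I (replicate 4 a) ℕ.+ occSum I (replicate m b) ≡⟨ cong₂ ℕ._+_ (occSum-replicate I 4 a) (occSum-replicate I m b) ⟩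
    4 * occ I a ℕ.+ m * occ I b                    ≡⟨ cong₂ (λ u v → 4 * u ℕ.+ m * v) occ-a occ-b ⟩
    8 ℕ.+ m * (2 ℕ.+ m)                              ∎
    where open ≡-Reasoning

  nai-value : occSum I I ÷ n ≡ n ÷ 1 - 4 ÷ 1 + 8 ÷ n
  nai-value = trans (cong (_÷ n) occSum-self)
    (÷≡÷-÷+÷ (4 ℕ.+ (2 ℕ.+ m) * (2 ℕ.+ m)) (3 ℕ.+ m) n 0 4 0 8 (3 ℕ.+ m) (cross m))
    where
    cross : ∀ m → ((4 ℕ.+ (2 ℕ.+ m) * (2 ℕ.+ m)) * 1 ℕ.+ 4 * (4 ℕ.+ m)) * (1 * (4 ℕ.+ m))
                ≡ ((4 ℕ.+ m) * (4 ℕ.+ m) ℕ.+ 8 * 1) * ((4 ℕ.+ m) * 1)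
    cross = solve-∀

  -- Since a₂ = a₁, every feasible sequence starts with a, a; after that no item occurs more than 2 + m times.
  optValue : OptValue I (n ÷ 1 - 4 ÷ 1 + 8 ÷ n)
  optValue = subst (OptValue I) nai-value $ subst (λ ℓ → OptValue I (occSum I I ÷ ℓ)) length-I $
    optValue-attained I I (occSum I I) (refl , validFrom-self a _) refl
      λ { (_ ∷ _ ∷ S) (refl , inj₁ refl , valid) → stays-below valid
        ; (_ ∷ _ ∷ S) (refl , inj₂ refl , valid) → stays-below valid }
    where
    stays-below : ∀ {S} → ValidFrom a (replicate (2 ℕ.+ m) b) S → occSum I (a ∷ a ∷ S) ≤ occSum I I
    stays-below {S} valid = ℕₚ.+-monoʳ-≤ (occ I a) (ℕₚ.+-monoʳ-≤ (occ I a) (subst (occSum I S ≤_)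
      (sym (trans (occSum-replicate I (2 ℕ.+ m) b) (cong ((2 ℕ.+ m) *_) occ-b)))
      (subst (λ ℓ → occSum I S ≤ ℓ * (2 ℕ.+ m)) (List.length-replicate (2 ℕ.+ m))
        (validFrom-occSum-≤ I (2 ℕ.+ m) occ-≤ valid))))

  nai-profit : profit I (nai I) ≡ n ÷ 1 - 4 ÷ 1 + 8 ÷ n
  nai-profit = trans (profit≡occSum÷n I) nai-value

  eag-profit : profit I (eag I) ≡ 2 ÷ 1
  eag-profit = begin
    profit I (eag I)           ≡⟨ cong (profit I) eag-I ⟩
    profit I (replicate n a)   ≡⟨ profit≡occSum÷n (replicate n a) ⟩
    occSum I (replicate n a) ÷ n ≡⟨ cong (_÷ n) (trans (occSum-replicate I n a) (cong (n *_) occ-a)) ⟩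
    (n * 2) ÷ n              ≡⟨ ÷-cross (n * 2) (3 ℕ.+ m) 2 0 (cross m) ⟩
    2 ÷ 1                      ∎
    where
    open ≡-Reasoning
    cross : ∀ m → (4 ℕ.+ m) * 2 * 1 ≡ 2 * (4 ℕ.+ m)
    cross = solve-∀

  maj-profit : profit I (maj I) ≡ n ÷ 1 - 6 ÷ 1 + 16 ÷ n
  maj-profit = trans (profit≡occSum÷n (maj I)) (trans (cong (_÷ n) occSum-maj)
    (÷≡÷-÷+÷ (8 ℕ.+ m * (2 ℕ.+ m)) (3 ℕ.+ m) n 0 6 0 16 (3 ℕ.+ m) (cross m)))
    where
    cross : ∀ m → ((8 ℕ.+ m * (2 ℕ.+ m)) * 1 ℕ.+ 6 * (4 ℕ.+ m)) * (1 * (4 ℕ.+ m))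
                ≡ ((4 ℕ.+ m) * (4 ℕ.+ m) ℕ.+ 16 * 1) * ((4 ℕ.+ m) * 1)
    cross = solve-∀

data Halves : ℕ → Set where
  halves : ∀ k′ r → r ≤ 1 → Halves (suc k′ * 2 ℕ.+ r)

halves-2+ : ∀ m → Halves (2 ℕ.+ m)
halves-2+ zero                = halves 0 0 z≤n
halves-2+ (suc zero)          = halves 0 1 (s≤s z≤n)
halves-2+ (suc (suc m)) with halves-2+ m
... | halves k′ r r≤1 = halves (suc k′) r r≤1

[k*2+r]%2≡r : ∀ k {r} → r ≤ 1 → (k * 2 ℕ.+ r) % 2 ≡ r
[k*2+r]%2≡r k {r} r≤1 = trans (cong (_% 2) (ℕₚ.+-comm (k * 2) r)) (trans ([m+kn]%n≡m%n r k 2) (small r≤1))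
  where
  small : r ≤ 1 → r % 2 ≡ r
  small z≤n       = refl
  small (s≤s z≤n) = refl

module Alternation (f : ℕ → Item) (f-injective : Injective _≡_ _≡_ f) where

  alternating : ℕ → ℕ → List Item
  alternating j zero    = []
  alternating j (suc k) = f (suc j) ∷ f 0 ∷ alternating (suc j) k

  -- Maj buffers every f (1+j) on arrival and loses it again on the following f 0.
  doubled : ℕ → ℕ → List Item
  doubled j zero    = []
  doubled j (suc k) = f (suc j) ∷ f (suc j) ∷ doubled (suc j) k

  f-suc≢f-0 : ∀ {t} → ¬ f (suc t) ≡ f 0
  f-suc≢f-0 eq = ℕₚ.1+n≢0 (f-injective eq)

  f-0≢f-suc : ∀ {t} → ¬ f 0 ≡ f (suc t)
  f-0≢f-suc eq = f-suc≢f-0 (sym eq)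

  f-suc-injective : ∀ {s t} → ¬ s ≡ t → ¬ f (suc s) ≡ f (suc t)
  f-suc-injective s≢t eq = s≢t (ℕₚ.suc-injective (f-injective eq))

  length-alternating : ∀ j k → length (alternating j k) ≡ k * 2
  length-alternating j zero    = refl
  length-alternating j (suc k) = cong (λ ℓ → 2 ℕ.+ ℓ) (length-alternating (suc j) k)

  occ-alternating-0 : ∀ j k → occ (alternating j k) (f 0) ≡ k
  occ-alternating-0 j zero    = refl
  occ-alternating-0 j (suc k) =
    trans (occ-there _ f-suc≢f-0) (trans (occ-here (f 0) _) (cong suc (occ-alternating-0 (suc j) k)))

  occ-alternating-outside : ∀ j k t → t < j ⊎ j ℕ.+ k ≤ t → occ (alternating j k) (f (suc t)) ≡ 0
  occ-alternating-outside j zero    t _ = refl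
  occ-alternating-outside j (suc k) t outside =
    trans (occ-there _ (f-suc-injective j≢t)) (trans (occ-there _ f-0≢f-suc)
      (occ-alternating-outside (suc j) k t (Sum.map ℕₚ.m<n⇒m<1+n (subst (_≤ t) (ℕₚ.+-suc j k)) outside)))
    where
    j≢t : ¬ j ≡ t
    j≢t refl = Sum.[ ℕₚ.<-irrefl refl , ℕₚ.m+1+n≰m j ] outside

  occ-alternating-inside : ∀ j k t → j ≤ t → t < j ℕ.+ k → occ (alternating j k) (f (suc t)) ≡ 1
  occ-alternating-inside j zero    t j≤t t<j+0 = ⊥-elim (ℕₚ.<⇒≱ (subst (t <_) (ℕₚ.+-identityʳ j) t<j+0) j≤t)
  occ-alternating-inside j (suc k) t j≤t t<j+1+k with j ℕ.≟ t
  ... | yes refl = trans (occ-here (f (suc j)) _) (cong suc (trans (occ-there _ f-0≢f-suc)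
                     (occ-alternating-outside (suc j) k j (inj₁ ℕₚ.≤-refl))))
  ... | no  j≢t  = trans (occ-there _ (f-suc-injective j≢t)) (trans (occ-there _ f-0≢f-suc)
                     (occ-alternating-inside (suc j) k t (ℕₚ.≤∧≢⇒< j≤t j≢t) (subst (t <_) (ℕₚ.+-suc j k) t<j+1+k)))

  occ-alternating-≤1 : ∀ j k {x} → ¬ x ≡ f 0 → occ (alternating j k) x ≤ 1
  occ-alternating-≤1 j zero    _ = z≤n
  occ-alternating-≤1 j (suc k) {x} x≢f0 with f (suc j) ℕ.≟ x
  ... | yes refl = ℕₚ.≤-reflexive (occ-alternating-inside j (suc k) j ℕₚ.≤-refl (ℕₚ.m<m+n j (s≤s z≤n)))
  ... | no  fj≢x = subst (_≤ 1) (sym (trans (occ-there _ fj≢x) (occ-there _ (λ eq → x≢f0 (sym eq)))))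
                     (occ-alternating-≤1 (suc j) k x≢f0)

  OnceIn : List Item → ℕ → ℕ → Set
  OnceIn I j k = ∀ t → j ≤ t → t < j ℕ.+ k → occ I (f (suc t)) ≡ 1

  once-head : ∀ I {j k} → OnceIn I j (suc k) → occ I (f (suc j)) ≡ 1
  once-head I {j} once = once j ℕₚ.≤-refl (ℕₚ.m<m+n j (s≤s z≤n))

  once-tail : ∀ I {j k} → OnceIn I j (suc k) → OnceIn I (suc j) k
  once-tail I {j} {k} once t j<t t<j+1+k = once t (ℕₚ.<⇒≤ j<t) (subst (t <_) (sym (ℕₚ.+-suc j k)) t<j+1+k)

  occSum-alternating : ∀ I j k → OnceIn I j k → occSum I (alternating j k) ≡ k * suc (occ I (f 0))
  occSum-alternating I j zero    _    = refl
  occSum-alternating I j (suc k) once =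
    cong₂ (λ u v → u ℕ.+ (occ I (f 0) ℕ.+ v)) (once-head I once) (occSum-alternating I (suc j) k (once-tail I once))

  occSum-doubled : ∀ I j k → OnceIn I j k → occSum I (doubled j k) ≡ k * 2
  occSum-doubled I j zero    _    = refl
  occSum-doubled I j (suc k) once =
    cong₂ (λ u v → u ℕ.+ (u ℕ.+ v)) (once-head I once) (occSum-doubled I (suc j) k (once-tail I once))

  majGo-alternating : ∀ b j k T → majGo b 0 (alternating j k ++ T) ≡ doubled j k ++ maj T
  majGo-alternating b j zero    T = majGo-empty-counter b T
  majGo-alternating b j (suc k) T = cong (f (suc j) ∷_) (trans (majGo-disagree 0 _ f-0≢f-suc)
    (cong (f (suc j) ∷_) (majGo-alternating (f (suc j)) (suc j) k T)))

  linked-alternating : ∀ j k {T} → Linked _≢_ T → Linked _≢_ (f 0 ∷ T) →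
    Linked _≢_ (alternating j k ++ T) × Linked _≢_ (f 0 ∷ alternating j k ++ T)
  linked-alternating j zero    T-linked f0T-linked = T-linked , f0T-linked
  linked-alternating j (suc k) T-linked f0T-linked = linked , f-0≢f-suc ∷ linked
    where
    linked = f-suc≢f-0 ∷ proj₂ (linked-alternating (suc j) k T-linked f0T-linked)

  wItem-even : ∀ j → wItem f (j * 2) ≡ f (suc j)
  wItem-even j with (j * 2) % 2 | m*n%n≡0 j 2
  ... | .0 | refl = cong (f ∘ suc) (m*n/n≡m j 2)

  wItem-odd : ∀ j → wItem f (suc (j * 2)) ≡ f 0
  wItem-odd j with suc (j * 2) % 2 | [m+kn]%n≡m%n 1 j 2
  ... | .1 | refl = refl

  applyUpTo-wItem : ∀ j k {r} → r ≤ 1 → ∀ g → (∀ i → g i ≡ wItem f (j * 2 ℕ.+ i)) →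
    applyUpTo g (k * 2 ℕ.+ r) ≡ alternating j k ++ replicate r (f (suc (j ℕ.+ k)))
  applyUpTo-wItem j zero    z≤n           g g≗ = refl
  applyUpTo-wItem j zero    (s≤s z≤n)   g g≗ =
    cong (_∷ []) (trans (g≗ 0) (trans (cong (wItem f) (ℕₚ.+-identityʳ (j * 2)))
      (trans (wItem-even j) (cong (f ∘ suc) (sym (ℕₚ.+-identityʳ j))))))
  applyUpTo-wItem j (suc k) {r} r≤1 g g≗ =
    cong₂ _∷_ (trans (g≗ 0) (trans (cong (wItem f) (ℕₚ.+-identityʳ (j * 2))) (wItem-even j)))
    (cong₂ _∷_ (trans (g≗ 1) (trans (cong (wItem f) (ℕₚ.+-comm (j * 2) 1)) (wItem-odd j)))
    (trans (applyUpTo-wItem (suc j) k r≤1 (g ∘ suc ∘ suc) (λ i → trans (g≗ (2 ℕ.+ i)) (cong (wItem f) (shift j i))))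
           (cong (λ t → alternating (suc j) k ++ replicate r (f (suc t))) (sym (ℕₚ.+-suc j k)))))
    where
    shift : ∀ j i → j * 2 ℕ.+ (2 ℕ.+ i) ≡ suc j * 2 ℕ.+ i
    shift = solve-∀

  W≡alternating : ∀ k {r} → r ≤ 1 → W f (k * 2 ℕ.+ r) ≡ alternating 0 k ++ replicate r (f (suc k))
  W≡alternating k r≤1 = trans (List.map-upTo (wItem f) _) (applyUpTo-wItem 0 k r≤1 (wItem f) (λ _ → refl))

  module Wₙ (k′ r : ℕ) (r≤1 : r ≤ 1) where

    k n : ℕ
    k = suc k′
    n = k * 2 ℕ.+ r

    T I : List Item
    T = replicate r (f (suc k))
    I = alternating 0 k ++ T

    length-I : length I ≡ n
    length-I = trans (List.length-++ (alternating 0 k))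
                     (cong₂ ℕ._+_ (length-alternating 0 k) (List.length-replicate r))

    occ-I : ∀ x → occ I x ≡ occ (alternating 0 k) x ℕ.+ occ T x
    occ-I = occ-++ (alternating 0 k) T

    occ-0 : occ I (f 0) ≡ k
    occ-0 = trans (occ-I (f 0)) (trans (cong₂ ℕ._+_ (occ-alternating-0 0 k) (occ-replicate-≢ r f-suc≢f-0)) (ℕₚ.+-identityʳ k))

    once : OnceIn I 0 (k ℕ.+ r)
    once t _ t<k+r with ℕₚ.<-cmp t k
    ... | tri< t<k _ _ = trans (occ-I _) (cong₂ ℕ._+_ (occ-alternating-inside 0 k t z≤n t<k)
                           (occ-replicate-≢ r (f-suc-injective (ℕₚ.>⇒≢ t<k))))
    ... | tri≈ _ refl _ = trans (occ-I _) (cong₂ ℕ._+_ (occ-alternating-outside 0 k k (inj₂ ℕₚ.≤-refl))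
                           (trans (occ-replicate r _) (ℕₚ.≤-antisym r≤1 (ℕₚ.+-cancelˡ-≤ k 1 r (subst (_≤ k ℕ.+ r) (ℕₚ.+-comm 1 k) t<k+r)))))
    ... | tri> _ _ k<t  = ⊥-elim (ℕₚ.<⇒≱ t<k+r (ℕₚ.≤-trans (ℕₚ.+-monoʳ-≤ k r≤1) (subst (_≤ t) (ℕₚ.+-comm 1 k) k<t)))

    occ-≤ : ∀ x → occ I x ≤ k
    occ-≤ x with x ℕ.≟ f 0 | f (suc k) ℕ.≟ x
    ... | yes refl | _        = ℕₚ.≤-reflexive occ-0
    ... | no  _    | yes refl = subst (_≤ k) (sym (trans (occ-I _)
                                  (cong (ℕ._+ occ T (f (suc k))) (occ-alternating-outside 0 k k (inj₂ ℕₚ.≤-refl)))))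
                                  (ℕₚ.≤-trans (ℕₚ.≤-trans (ℕₚ.≤-reflexive (occ-replicate r _)) r≤1) (s≤s z≤n))
    ... | no  x≢f0 | no  fk≢x = subst (_≤ k) (sym (trans (occ-I x) (trans (cong (occ (alternating 0 k) x ℕ.+_) (occ-replicate-≢ r fk≢x)) (ℕₚ.+-identityʳ _))))
                                  (ℕₚ.≤-trans (occ-alternating-≤1 0 k x≢f0) (s≤s z≤n))

    profit≡occSum÷n : ∀ S → profit I S ≡ occSum I S ÷ n
    profit≡occSum÷n S = trans (profit≡occSum÷length I S) (cong (occSum I S ÷_) length-I)

    occSum-T : occSum I T ≡ r
    occSum-T = trans (occSum-replicate I r (f (suc k))) (counted-once r≤1)
      where
      counted-once : r ≤ 1 → r * occ I (f (suc k)) ≡ r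
      counted-once z≤n       = refl
      counted-once (s≤s z≤n) = trans (ℕₚ.+-identityʳ _) (once k z≤n (ℕₚ.m<m+n k (s≤s z≤n)))

    occSum-self : occSum I I ≡ k * suc k ℕ.+ r
    occSum-self = trans (occSum-++ I (alternating 0 k) T)
      (cong₂ ℕ._+_ (trans (occSum-alternating I 0 k (λ t _ t<k → once t z≤n (ℕₚ.≤-trans t<k (ℕₚ.m≤m+n k r))))
                          (cong (λ c → k * suc c) occ-0))
                   occSum-T)

    nai-profit : profit I (nai I) ≡ (k * suc k ℕ.+ r) ÷ n
    nai-profit = trans (profit≡occSum÷n I) (cong (_÷ n) occSum-self)

    eag-profit : profit I (eag I) ≡ profit I (nai I)
    eag-profit = cong (profit I) (linked⇒eag≡id (proj₁ (linked-alternating 0 k (linked-T r≤1) (linked-f0T r≤1))))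
      where
      linked-T : r ≤ 1 → Linked _≢_ T
      linked-T z≤n       = []
      linked-T (s≤s z≤n) = [-]
      linked-f0T : r ≤ 1 → Linked _≢_ (f 0 ∷ T)
      linked-f0T z≤n       = [-]
      linked-f0T (s≤s z≤n) = f-0≢f-suc ∷ [-]

    maj-profit : profit I (maj I) ≡ 1 ÷ 1
    maj-profit = trans (profit≡occSum÷n (maj I)) (trans (cong (_÷ n) (begin
      occSum I (maj I)                          ≡⟨ cong (occSum I) (majGo-alternating 0 0 k T) ⟩
      occSum I (doubled 0 k ++ maj T)           ≡⟨ occSum-++ I (doubled 0 k) (maj T) ⟩
      occSum I (doubled 0 k) ℕ.+ occSum I (maj T) ≡⟨ cong₂ ℕ._+_ (occSum-doubled I 0 k (λ t _ t<k → once t z≤n (ℕₚ.≤-trans t<k (ℕₚ.m≤m+n k r))))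
                                                                (cong (occSum I) (maj-T r≤1)) ⟩
      k * 2 ℕ.+ occSum I T                    ≡⟨ cong (k * 2 ℕ.+_) occSum-T ⟩
      n                                         ∎)) (n÷n≡1 (suc (k′ * 2 ℕ.+ r))))
      where
      open ≡-Reasoning
      maj-T : r ≤ 1 → maj T ≡ T
      maj-T z≤n       = refl
      maj-T (s≤s z≤n) = refl

    on-W : (P : List Item → Set) → P I → P (W f n)
    on-W P = subst P (sym (W≡alternating k r≤1))

    optValue : OptValue I ((1 ℕ.+ suc (k′ * 2 ℕ.+ r) * k) ÷ n)
    optValue = subst (OptValue I) value (optValue-switch-to-second (f 1) (f 0) R (λ x → subst (occ I x ≤_) (sym occ-0) (occ-≤ x)))
      where
      R = alternating 1 k′ ++ T
      length-R : length R ≡ k′ * 2 ℕ.+ r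
      length-R = ℕₚ.suc-injective (ℕₚ.suc-injective length-I)
      value : (occ I (f 1) ℕ.+ suc (length R) * occ I (f 0)) ÷ suc (suc (length R)) ≡ (1 ℕ.+ suc (k′ * 2 ℕ.+ r) * k) ÷ n
      value = trans (cong (λ c → (occ I (f 1) ℕ.+ suc (length R) * c) ÷ suc (suc (length R))) occ-0)
                    (cong₂ (λ c ℓ → (c ℕ.+ suc ℓ * k) ÷ suc (suc ℓ))
                      (once 0 z≤n (s≤s z≤n)) length-R)

module W-values (k′ : ℕ) where

  k d₀ d₁ : ℕ
  k  = suc k′
  d₀ = suc (k′ * 2 ℕ.+ 0)
  d₁ = suc (k′ * 2 ℕ.+ 1)

  even-nai : (k * suc k ℕ.+ 0) ÷ suc d₀ ≡ suc d₀ ÷ 4 + 1 ÷ 2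
  even-nai = ÷≡÷+÷ (k * suc k ℕ.+ 0) d₀ (suc d₀) 3 1 1 (cross k′)
    where
    cross : ∀ k′ → (suc k′ * suc (suc k′) ℕ.+ 0) * (4 * 2)
                 ≡ (suc (suc (k′ * 2 ℕ.+ 0)) * 2 ℕ.+ 1 * 4) * suc (suc (k′ * 2 ℕ.+ 0))
    cross = solve-∀

  odd-nai : (k * suc k ℕ.+ 1) ÷ suc d₁ ≡ suc d₁ ÷ 4 + 3 ÷ (4 * suc d₁)
  odd-nai = ÷≡÷+÷ (k * suc k ℕ.+ 1) d₁ (suc d₁) 3 3 (d₁ ℕ.+ 3 * suc d₁) (cross k′)
    where
    cross : ∀ k′ → (suc k′ * suc (suc k′) ℕ.+ 1) * (4 * (4 * suc (suc (k′ * 2 ℕ.+ 1))))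
                 ≡ (suc (suc (k′ * 2 ℕ.+ 1)) * (4 * suc (suc (k′ * 2 ℕ.+ 1))) ℕ.+ 3 * 4) * suc (suc (k′ * 2 ℕ.+ 1))
    cross = solve-∀

  even-opt : (1 ℕ.+ suc (k′ * 2 ℕ.+ 0) * k) ÷ suc d₀ ≡ suc d₀ ÷ 2 - 1 ÷ 2 + 1 ÷ suc d₀
  even-opt = ÷≡÷-÷+÷ (1 ℕ.+ suc (k′ * 2 ℕ.+ 0) * k) d₀ (suc d₀) 1 1 1 1 d₀ (cross k′)
    where
    cross : ∀ k′ → let n = suc (suc (k′ * 2 ℕ.+ 0)) in
      ((1 ℕ.+ suc (k′ * 2 ℕ.+ 0) * suc k′) * 2 ℕ.+ 1 * n) * (2 * n) ≡ (n * n ℕ.+ 1 * 2) * (n * 2)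
    cross = solve-∀

  odd-opt : (1 ℕ.+ suc (k′ * 2 ℕ.+ 1) * k) ÷ suc d₁ ≡ suc d₁ ÷ 2 - 1 ÷ 1 + 3 ÷ (2 * suc d₁)
  odd-opt = ÷≡÷-÷+÷ (1 ℕ.+ suc (k′ * 2 ℕ.+ 1) * k) d₁ (suc d₁) 1 1 0 3 (d₁ ℕ.+ 1 * suc d₁) (cross k′)
    where
    cross : ∀ k′ → let n = suc (suc (k′ * 2 ℕ.+ 1)) in
      ((1 ℕ.+ suc (k′ * 2 ℕ.+ 1) * suc k′) * 1 ℕ.+ 1 * n) * (2 * (2 * n)) ≡ (n * (2 * n) ℕ.+ 3 * 2) * (n * 1)
    cross = solve-∀

W-claims : ∀ f → Injective _≡_ _≡_ f → ∀ {n} → Halves n →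
    (n % 2 ≡ 0 → profit (W f n) (nai (W f n)) ≡ (n ÷ 4) + (1 ÷ 2))
  × (n % 2 ≡ 1 → profit (W f n) (nai (W f n)) ≡ (n ÷ 4) + (3 ÷ (4 * n)))
  × (profit (W f n) (eag (W f n)) ≡ profit (W f n) (nai (W f n)))
  × (profit (W f n) (maj (W f n)) ≡ 1 ÷ 1)
  × (n % 2 ≡ 0 → OptValue (W f n) ((n ÷ 2) - (1 ÷ 2) + (1 ÷ n)))
  × (n % 2 ≡ 1 → OptValue (W f n) ((n ÷ 2) - (1 ÷ 1) + (3 ÷ (2 * n))))
W-claims f f-injective (halves k′ 0 z≤n) =
    (λ _ → on-W (λ J → profit J (nai J) ≡ n ÷ 4 + 1 ÷ 2) (trans nai-profit even-nai))
  , (λ n%2≡1 → ⊥-elim (ℕₚ.0≢1+n (trans (sym ([k*2+r]%2≡r k z≤n)) n%2≡1)))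
  , on-W (λ J → profit J (eag J) ≡ profit J (nai J)) eag-profit
  , on-W (λ J → profit J (maj J) ≡ 1 ÷ 1) maj-profit
  , (λ _ → on-W (λ J → OptValue J (n ÷ 2 - 1 ÷ 2 + 1 ÷ n)) (subst (OptValue I) even-opt optValue))
  , (λ n%2≡1 → ⊥-elim (ℕₚ.0≢1+n (trans (sym ([k*2+r]%2≡r k z≤n)) n%2≡1)))
  where
  open Alternation f f-injective
  open Wₙ k′ 0 z≤n
  open W-values k′ using (even-nai; even-opt)
W-claims f f-injective (halves k′ 1 (s≤s z≤n)) =
    (λ n%2≡0 → ⊥-elim (ℕₚ.1+n≢0 (trans (sym ([k*2+r]%2≡r k (s≤s z≤n))) n%2≡0)))
  , (λ _ → on-W (λ J → profit J (nai J) ≡ n ÷ 4 + 3 ÷ (4 * n)) (trans nai-profit odd-nai))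
  , on-W (λ J → profit J (eag J) ≡ profit J (nai J)) eag-profit
  , on-W (λ J → profit J (maj J) ≡ 1 ÷ 1) maj-profit
  , (λ n%2≡0 → ⊥-elim (ℕₚ.1+n≢0 (trans (sym ([k*2+r]%2≡r k (s≤s z≤n))) n%2≡0)))
  , (λ _ → on-W (λ J → OptValue J (n ÷ 2 - 1 ÷ 1 + 3 ÷ (2 * n))) (subst (OptValue I) odd-opt optValue))
  where
  open Alternation f f-injective
  open Wₙ k′ 1 (s≤s z≤n)
  open W-values k′ using (odd-nai; odd-opt)

proposition1 : (n : ℕ) → 4 ≤ n →
    ((a b : Item) → a ≢ b →
        (profit (E a b n) (nai (E a b n)) ≡ (n ÷ 1) - (4 ÷ 1) + (8 ÷ n))
      × (profit (E a b n) (eag (E a b n)) ≡ 2 ÷ 1)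
      × (profit (E a b n) (maj (E a b n)) ≡ (n ÷ 1) - (6 ÷ 1) + (16 ÷ n))
      × OptValue (E a b n) ((n ÷ 1) - (4 ÷ 1) + (8 ÷ n)))
    × ((f : ℕ → Item) → Injective _≡_ _≡_ f →
        (n % 2 ≡ 0 → profit (W f n) (nai (W f n)) ≡ (n ÷ 4) + (1 ÷ 2))
      × (n % 2 ≡ 1 → profit (W f n) (nai (W f n)) ≡ (n ÷ 4) + (3 ÷ (4 * n)))
      × (profit (W f n) (eag (W f n)) ≡ profit (W f n) (nai (W f n)))
      × (profit (W f n) (maj (W f n)) ≡ 1 ÷ 1)
      × (n % 2 ≡ 0 → OptValue (W f n) ((n ÷ 2) - (1 ÷ 2) + (1 ÷ n)))
      × (n % 2 ≡ 1 → OptValue (W f n) ((n ÷ 2) - (1 ÷ 1) + (3 ÷ (2 * n)))))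
proposition1 (suc (suc (suc (suc m)))) (s≤s (s≤s (s≤s (s≤s z≤n)))) =
    (λ a b a≢b → let open Eₙ a b a≢b m in
      nai-profit , eag-profit , maj-profit , optValue)
  , λ f f-injective → W-claims f f-injective (halves-2+ (2 ℕ.+ m))
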